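{- Let $A$ be a connected simple graph on $[n]$ with $n>2$, let $B=(b_{ij})$ be its binding graph on $[n_1]$, $n_1=n(n+1)/2$, and let $\hat B=(m_{ij})$ be the stable graph of $B$. Define $\Psi=(\psi_{ij})$ by $\psi_{ij}=x_0$ if $i\ne j$ and $b_{ij}=x_0$, and $\psi_{ij}=m_{ij}$ otherwise; and $\Phi=(\phi_{ij})$ by $\phi_{ij}=x_0$ if $i,j\in[n]$ and $i\ne j$, and $\phi_{ij}=\psi_{ij}$ otherwise. Then $\mathrm{Aut}(B)=\mathrm{Aut}(\hat B)=\mathrm{Aut}(\hat\Psi)=\mathrm{Aut}(\hat\Phi)=\mathrm{Aut}(\Phi)$.
   Context: Labels are independent commuting indeterminates $x_0,x_1,\dots$; $\mathrm{Var}=\{x_1,x_2,\dots\}$. A graph of order $N$ is a symmetric $N\times N$ matrix over $\{x_0\}\cup\mathrm{Var}$ on vertex set $[N]$; for $i\ne j$, $(i,j)$ is an edge iff the entry is not $x_0$. A simple graph has all diagonal entries $x_0$ and at most two distinct entries. An automorphism of $G$ is a permutation $\sigma$ of $[N]$ with $g_{i^\sigma j^\sigma}=g_{ij}$ for all $i,j$. Products/powers ($G^0=I$) are computed in the commutative polynomial ring over $\mathbb{R}$ in the indeterminates and an extra indeterminate $\lambda$. $A\approx B$ means $a_{ij}=a_{st}\iff b_{ij}=b_{st}$ for all $i,j,s,t$. An equivalent variable substitution replaces the entries of a matrix by variables of $\mathrm{Var}$, equal entries by equal variables and distinct by distinct. Description graph $\tilde G$: obtained from $\Gamma(G)=\sum_{k=0}^{N-1}\lambda^kG^k$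 by an equivalent variable substitution. Stable graph $\hat G$: iterate $G_0=G$, $G_{k+1}=\tilde{G_k}$ until the number of distinct entries stops increasing; the final graph (defined up to $\approx$) is $\hat G$. The binding graph $B$ of a simple graph $A$ on $[n]$ is the simple graph on $[n_1]$ whose subgraph induced on $[n]$ is $A$ and in which each pair of distinct $u,v\in[n]$ has a unique vertex $p\in\{n+1,\dots,n_1\}$ adjacent exactly to $u$ and $v$, binding edges carrying the same label as edges of $A$. -}

module Defs where

open import Data.Nat using (ℕ; zero; suc; _+_; _*_; _<_; _≤_; _<?_)
open import Data.Nat.Properties using (≤-decTotalOrder)
import Data.Nat as ℕ
open import Data.Fin using (Fin; toℕ; _↑ˡ_; _↑ʳ_)
import Data.Fin as F
open import Data.List using (List; []; _∷_; _++_; map; concatMap; allFin; length; deduplicate; foldr; concat; upTo)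
open import Data.List.Relation.Binary.Permutation.Propositional using (_↭_)
open import Data.List.Sort ≤-decTotalOrder using (sort)
open import Data.Product using (Σ; ∃; _×_; _,_)
open import Data.Sum using (_⊎_)
open import Data.Fin.Permutation using (Permutation′; _⟨$⟩ʳ_)
open import Relation.Binary.PropositionalEquality using (_≡_)
open import Relation.Nullary using (¬_; yes; no)

-- Labels: the label x_i is represented by its index i : ℕ.
-- x₀ is 0; Var = {x₁, x₂, …} = the positive naturals.

x₀ : ℕ
x₀ = 0

Mat : ℕ → Set
Mat N = Fin N → Fin N → ℕ

Symmetric : ∀ {N} → Mat N → Set
Symmetric G = ∀ i j → G i j ≡ G j i

Adj : ∀ {N} → Mat N → Fin N → Fin N → Set
Adj G i j = (¬ i ≡ j) × (¬ G i j ≡ x₀)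

data Reach {N} (G : Mat N) : Fin N → Fin N → Set where
  here : ∀ {i} → Reach G i i
  step : ∀ {i j k} → Adj G i j → Reach G j k → Reach G i k

Connected : ∀ {N} → Mat N → Set
Connected G = ∀ i j → Reach G i j

Simple : ∀ {N} → Mat N → Set
Simple G = (∀ i → G i i ≡ x₀) × ∃ λ a → ∀ i j → G i j ≡ x₀ ⊎ G i j ≡ a

-- Polynomials with ℕ coefficients in the indeterminates λ, x₀, x₁, …
-- (all matrices here have entries in this subsemiring of ℝ[λ, x₀, x₁, …]).
-- A monomial λ^a · x_{v₁} ⋯ x_{v_r} is (a , [v₁, …, v_r]) (order irrelevant);
-- a polynomial is a list of monomials (a multiset, i.e. ℕ-coefficients).

Monomial : Set
Monomial = ℕ × List ℕ

Poly : Set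
Poly = List Monomial

mulM : Monomial → Monomial → Monomial
mulM (a , xs) (b , ys) = (a + b , xs ++ ys)

_+P_ : Poly → Poly → Poly
p +P q = p ++ q

_*P_ : Poly → Poly → Poly
p *P q = concatMap (λ m → map (mulM m) q) p

λ^_·_ : ℕ → Poly → Poly
λ^ k · p = map (λ { (a , xs) → (a + k , xs) }) p

normM : Monomial → Monomial
normM (a , xs) = (a , sort xs)

_≡P_ : Poly → Poly → Set
p ≡P q = map normM p ↭ map normM q

PMat : ℕ → Set
PMat N = Fin N → Fin N → Poly

toP : ∀ {N} → Mat N → PMat N
toP G i j = (0 , G i j ∷ []) ∷ []

sumP : List Poly → Poly
sumP = foldr _+P_ []

_⊗_ : ∀ {N} → PMat N → PMat N → PMat N
_⊗_ {N} P Q i j = sumP (map (λ l → P i l *P Q l j) (allFin N))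

idP : ∀ {N} → PMat N
idP i j with i F.≟ j
... | yes _ = (0 , []) ∷ []
... | no _ = []

_^P_ : ∀ {N} → PMat N → ℕ → PMat N
P ^P zero = idP
P ^P suc k = (P ^P k) ⊗ P

Γ : ∀ {N} → Mat N → PMat N
Γ {N} G i j = sumP (map (λ k → λ^ k · ((toP G ^P k) i j)) (upTo N))

-- Description graph: H is obtained from Γ(G) by an equivalent variable
-- substitution (entries in Var, same equality pattern).

Desc : ∀ {N} → Mat N → Mat N → Set
Desc G H =
  (∀ i j → 1 ≤ H i j) ×
  (∀ i j s t → ((Γ G i j ≡P Γ G s t) → H i j ≡ H s t)
             × (H i j ≡ H s t → (Γ G i j ≡P Γ G s t)))

entries : ∀ {N} → Mat N → List ℕ
entries {N} G = concatMap (λ i → map (G i) (allFin N)) (allFin N)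

distinct : ∀ {N} → Mat N → ℕ
distinct G = length (deduplicate ℕ._≟_ (entries G))

Stable : ∀ {N} → Mat N → Mat N → Set
Stable {N} G H =
  Σ ℕ λ k → Σ (ℕ → Mat N) λ seq →
    (∀ i j → seq 0 i j ≡ G i j) ×
    (∀ m → Desc (seq m) (seq (suc m))) ×
    (∀ m → m < k → distinct (seq m) < distinct (seq (suc m))) ×
    (distinct (seq (suc k)) ≤ distinct (seq k)) ×
    (∀ i j → H i j ≡ seq k i j)

IsAut : ∀ {N} → Mat N → Permutation′ N → Set
IsAut G σ = ∀ i j → G (σ ⟨$⟩ʳ i) (σ ⟨$⟩ʳ j) ≡ G i j

SameAut : ∀ {N} → Mat N → Mat N → Set
SameAut {N} G H = ∀ (σ : Permutation′ N) → (IsAut G σ → IsAut H σ) × (IsAut H σ → IsAut G σ)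

-- Binding graph of A (on Fin n) : a graph B on Fin (n + k), where the
-- original vertex u is u ↑ˡ k and binding vertices are n ↑ʳ p.

IsBinding : ∀ {n k} → Mat n → Mat (n + k) → Set
IsBinding {n} {k} A B =
  Symmetric B × Simple B ×
  (∀ u v → B (u ↑ˡ k) (v ↑ˡ k) ≡ A u v) ×
  (∀ u v → ¬ u ≡ v →
     Σ (Fin k) λ p →
       (∀ w → Adj B (n ↑ʳ p) w → w ≡ u ↑ˡ k ⊎ w ≡ v ↑ˡ k) ×
       Adj B (n ↑ʳ p) (u ↑ˡ k) × Adj B (n ↑ʳ p) (v ↑ˡ k) ×
       (∀ q → (∀ w → Adj B (n ↑ʳ q) w → w ≡ u ↑ˡ k ⊎ w ≡ v ↑ˡ k) →
              Adj B (n ↑ʳ q) (u ↑ˡ k) → Adj B (n ↑ʳ q) (v ↑ˡ k) → q ≡ p))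

Ψ : ∀ {N} → Mat N → Mat N → Mat N
Ψ B M i j with i F.≟ j | B i j ℕ.≟ x₀
... | no _ | yes _ = x₀
... | _ | _ = M i j

Φ : ∀ {N} → ℕ → Mat N → Mat N
Φ n P i j with toℕ i <? n | toℕ j <? n | i F.≟ j
... | yes _ | yes _ | no _ = x₀
... | _ | _ | _ = P i j

-- Each description step preserves automorphisms: Γ(G) is invariant under Aut(G), and conversely the
-- coefficients of λ x_c and of λ² x_c² in Γ(G)ᵢⱼ are [gᵢⱼ = c] and the number of c-labelled 2-walks
-- from i to j, so a description graph refines G together with its 2-walk counts. Hence every stable
-- graph has the automorphisms of the graph it comes from, and B̂ (reached in at least one step, as the
-- description of B already has three distinct entries) knows the 2-walk counts of B. Ψ only zeroes
-- the non-edges of B in B̂, so it still determines B. For Φ: by counting, each of the k = n(n-1)/2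
-- extra vertices binds a pair of A, so it has degree 2, while an original vertex has degree at least 3
-- (two binding vertices and, A being connected, a neighbour in A). Degrees sit on the diagonal of B̂,
-- which Φ keeps, so an automorphism σ of Φ preserves [n]. The entries of Φ at binding vertices are
-- those of Ψ, so σ maps the binding vertex p of {u, v} to a binding vertex of {σu, σv}, and the number
-- of 2-walks from p to u, which is [u ~ v], is preserved; so σ preserves the edges of A as well.

module Submission where

open import Defs
import Algebra.Properties.CommutativeMonoid.Sum
open import Data.Empty using (⊥-elim)
open import Data.Fin as Fin using (Fin; zero; suc; toℕ; punchIn; _↑ˡ_; _↑ʳ_; splitAt)
import Data.Fin.Properties as Finₚ
open import Data.Fin.Permutation using (Permutation′; _⟨$⟩ʳ_)
open import Data.List using (List; []; _∷_; _++_; map; filter; tabulate; allFin; upTo; applyUpTo; length; deduplicate)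
open import Data.List.Properties
  using (length-++; length-++-sucʳ; tabulate-cong; map-tabulate; map-upTo; map-cong; map-id; ++-identityʳ;
         filter-++; filter-none; filter-accept; filter-reject)
open import Data.List.Membership.Propositional using (_∈_)
open import Data.List.Membership.Propositional.Properties
  using (∈-∃++; ∈-++⁻; ∈-++⁺ˡ; ∈-++⁺ʳ; ∈-map⁺; ∈-map⁻; ∈-allFin; ∈-concat⁺′; ∈-concat⁻′;
         ∈-deduplicate⁺; ∈-deduplicate⁻)
open import Data.List.Relation.Unary.All as All using (All; []; _∷_; all?)
import Data.List.Relation.Unary.All.Properties as Allₚ
open import Data.List.Relation.Unary.AllPairs using ([]; _∷_)
open import Data.List.Relation.Unary.Any using (here; there)
open import Data.List.Relation.Unary.Unique.Propositional using (Unique)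
open import Data.List.Relation.Binary.Permutation.Propositional
  using (_↭_; ↭-refl; ↭-sym; ↭-trans; ↭-reflexive; ↭-isEquivalence; ↭-setoid; ↭⇒↭ₛ′; module PermutationReasoning)
open import Data.List.Relation.Binary.Permutation.Propositional.Properties
  using (↭-length; filter-↭; All-resp-↭; map⁺; ++⁺; ++-commutativeMonoid; ++-isCommutativeMonoid)
import Data.Nat as ℕ
open import Data.Nat using (ℕ; zero; suc; _+_; _*_; _<_; _≤_; z≤n; s≤s; _<?_)
open import Data.Nat.Properties
  using (+-0-commutativeMonoid; ≤-decTotalOrder; ≤-refl; ≤-trans; +-mono-≤; m≤m+n; m≤n+m; +-identityʳ; +-comm;
         <-irrefl; ≮⇒≥; n≤0⇒n≡0; +-cancelˡ-≡; *-cancelʳ-≡)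
open import Data.Nat.Tactic.RingSolver using (solve-∀)
open import Data.List.Relation.Unary.Unique.DecPropositional.Properties ℕ._≟_ using (deduplicate-!)
open import Data.List.Sort ≤-decTotalOrder using (sort-↭)
open import Data.List.Relation.Binary.Permutation.Setoid.Properties (↭-setoid {A = Monomial}) using (foldr-commMonoid)
open import Data.Product using (Σ; ∃; _×_; _,_; proj₁; proj₂)
open import Data.Sum using (_⊎_; inj₁; inj₂)
open import Function using (_∘_; case_of_)
open import Function.Bundles using (Injection)
open import Function.Properties.Inverse using (↔⇒↣)
open import Relation.Binary.PropositionalEquality
  using (_≡_; _≢_; refl; sym; trans; cong; cong₂; subst; subst₂; module ≡-Reasoning)
open import Relation.Nullary using (¬_; Dec; yes; no)
open import Relation.Nullary.Decidable using (_×-dec_)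
open import Relation.Unary using (Decidable)

open import Algebra.Properties.CommutativeMonoid.Sum +-0-commutativeMonoid
  using (sum; sum-syntax; ∑-distrib-+; ∑-comm; sum-cong-≗; sum-remove)

𝟙 : ∀ {p} {P : Set p} → Dec P → ℕ
𝟙 (yes _) = 1
𝟙 (no _)  = 0

module _ {p} {P : Set p} where

  𝟙-yes : (d : Dec P) → P → 𝟙 d ≡ 1
  𝟙-yes (yes _) _  = refl
  𝟙-yes (no ¬p) p = ⊥-elim (¬p p)

  𝟙-no : (d : Dec P) → ¬ P → 𝟙 d ≡ 0
  𝟙-no (yes p) ¬p = ⊥-elim (¬p p)
  𝟙-no (no _)  _  = refl

  𝟙≤1 : (d : Dec P) → 𝟙 d ≤ 1
  𝟙≤1 (yes _) = s≤s z≤n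
  𝟙≤1 (no _)  = z≤n

  𝟙-sound : (d : Dec P) → 0 < 𝟙 d → P
  𝟙-sound (yes p) _ = p

  𝟙-cong : ∀ {q} {Q : Set q} (d : Dec P) (e : Dec Q) → (P → Q) → (Q → P) → 𝟙 d ≡ 𝟙 e
  𝟙-cong (yes _) (yes _) _ _ = refl
  𝟙-cong (yes p) (no ¬q) f _ = ⊥-elim (¬q (f p))
  𝟙-cong (no ¬p) (yes q) _ g = ⊥-elim (¬p (g q))
  𝟙-cong (no _)  (no _)  _ _ = refl

sum-mono-≤ : ∀ {N} {f g : Fin N → ℕ} → (∀ l → f l ≤ g l) → sum f ≤ sum g
sum-mono-≤ {zero}  _   = z≤n
sum-mono-≤ {suc _} f≤g = +-mono-≤ (f≤g zero) (sum-mono-≤ (f≤g ∘ suc))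

sum-zero : ∀ {N} {f : Fin N → ℕ} → (∀ l → f l ≡ 0) → sum f ≡ 0
sum-zero {zero}  _    = refl
sum-zero {suc _} f≡0 = cong₂ _+_ (f≡0 zero) (sum-zero (f≡0 ∘ suc))

sum-ones : ∀ N → ∑[ l < N ] 1 ≡ N
sum-ones zero    = refl
sum-ones (suc N) = cong suc (sum-ones N)

sum-single : ∀ {N} {f : Fin N → ℕ} u → (∀ l → l ≢ u → f l ≡ 0) → sum f ≡ f u
sum-single {suc _} {f} u f≡0 = begin
  sum f                        ≡⟨ sum-remove {i = u} f ⟩
  f u + sum (f ∘ punchIn u)    ≡⟨ cong (f u +_) (sum-zero (λ l → f≡0 _ (Finₚ.punchInᵢ≢i u l))) ⟩
  f u + 0                      ≡⟨ +-identityʳ (f u) ⟩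
  f u                          ∎
  where open ≡-Reasoning

sum-positive : ∀ {N} (f : Fin N → ℕ) → 0 < sum f → ∃ λ l → 0 < f l
sum-positive {suc _} f 0<Σ with f zero in eq
... | suc _ = zero , subst (0 <_) (sym eq) (s≤s z≤n)
... | zero  with sum-positive (f ∘ suc) 0<Σ
...   | l , 0<fl = suc l , 0<fl

δ : ∀ {N} → Fin N → Fin N → ℕ
δ u l = 𝟙 (l Fin.≟ u)

δ-self : ∀ {N} (u : Fin N) → δ u u ≡ 1
δ-self u = 𝟙-yes (u Fin.≟ u) refl

sum-δ : ∀ {N} (u : Fin N) → sum (δ u) ≡ 1
sum-δ u = trans (sum-single u (λ l l≢u → 𝟙-no (l Fin.≟ u) l≢u)) (δ-self u)

sum-≤1 : ∀ {N} (f : Fin N → ℕ) → (∀ l → f l ≤ 1) →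
         (∀ l l′ → 0 < f l → 0 < f l′ → l ≡ l′) → sum f ≤ 1
sum-≤1 f f≤1 unique with 0 <? sum f
... | no ¬pos = ≤-trans (≮⇒≥ ¬pos) z≤n
... | yes pos with sum-positive f pos
...   | u , 0<fu = subst (_≤ 1) (sym (sum-single u vanish)) (f≤1 u)
  where
  vanish : ∀ l → l ≢ u → f l ≡ 0
  vanish l l≢u = n≤0⇒n≡0 (≮⇒≥ (λ 0<fl → l≢u (unique l u 0<fl 0<fu)))

three-points≤sum : ∀ {N} (f : Fin N → ℕ) {l₁ l₂ l₃} → l₁ ≢ l₂ → l₁ ≢ l₃ → l₂ ≢ l₃ →
                   0 < f l₁ → 0 < f l₂ → 0 < f l₃ → 3 ≤ sum f
three-points≤sum f {l₁} {l₂} {l₃} l₁≢l₂ l₁≢l₃ l₂≢l₃ p₁ p₂ p₃ =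
  subst (_≤ sum f) three (sum-mono-≤ below)
  where
  three : ∑[ l < _ ] (δ l₁ l + δ l₂ l + δ l₃ l) ≡ 3
  three = trans (∑-distrib-+ (λ l → δ l₁ l + δ l₂ l) (δ l₃))
            (cong₂ _+_ (trans (∑-distrib-+ (δ l₁) (δ l₂)) (cong₂ _+_ (sum-δ l₁) (sum-δ l₂))) (sum-δ l₃))
  below : ∀ l → δ l₁ l + δ l₂ l + δ l₃ l ≤ f l
  below l with l Fin.≟ l₁ | l Fin.≟ l₂ | l Fin.≟ l₃
  ... | yes refl | yes refl | _        = ⊥-elim (l₁≢l₂ refl)
  ... | yes refl | no _     | yes refl = ⊥-elim (l₁≢l₃ refl)
  ... | no _     | yes refl | yes refl = ⊥-elim (l₂≢l₃ refl)
  ... | yes refl | no _     | no _     = p₁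
  ... | no _     | yes refl | no _     = p₂
  ... | no _     | no _     | yes refl = p₃
  ... | no _     | no _     | no _     = z≤n

sum≤two-points : ∀ {N} (f : Fin N → ℕ) {l₁ l₂} → (∀ l → f l ≤ 1) →
                 (∀ l → 0 < f l → l ≡ l₁ ⊎ l ≡ l₂) → sum f ≤ 2
sum≤two-points f {l₁} {l₂} f≤1 support =
  subst (sum f ≤_) (trans (∑-distrib-+ (δ l₁) (δ l₂)) (cong₂ _+_ (sum-δ l₁) (sum-δ l₂))) (sum-mono-≤ above)
  where
  above : ∀ l → f l ≤ δ l₁ l + δ l₂ l
  above l with 0 <? f l
  ... | no ¬pos = ≤-trans (≮⇒≥ ¬pos) z≤n
  ... | yes pos with support l pos
  ...   | inj₁ refl = ≤-trans (f≤1 l) (subst (λ x → 1 ≤ x + δ l₂ l) (sym (δ-self l)) (m≤m+n 1 _))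
  ...   | inj₂ refl = ≤-trans (f≤1 l) (subst (λ x → 1 ≤ δ l₁ l + x) (sym (δ-self l)) (m≤n+m 1 _))

≤1∧sum≡size⇒positive : ∀ {N} (f : Fin N → ℕ) → (∀ l → f l ≤ 1) → sum f ≡ N → ∀ u → 0 < f u
≤1∧sum≡size⇒positive {N} f f≤1 Σf≡N u with 0 <? f u
... | yes pos = pos
... | no ¬pos = ⊥-elim (<-irrefl refl (subst₂ _≤_ total (sum-ones N) (sum-mono-≤ at-most-one)))
  where
  total : sum (λ l → f l + δ u l) ≡ suc N
  total = trans (∑-distrib-+ f (δ u)) (trans (cong₂ _+_ Σf≡N (sum-δ u)) (+-comm N 1))
  at-most-one : ∀ l → f l + δ u l ≤ 1
  at-most-one l with l Fin.≟ u
  ... | yes refl = subst (λ x → x + 1 ≤ 1) (sym (n≤0⇒n≡0 (≮⇒≥ ¬pos))) ≤-refl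
  ... | no _     = subst (_≤ 1) (sym (+-identityʳ (f l))) (f≤1 l)

applyUpTo≡tabulate : ∀ {a} {A : Set a} (f : ℕ → A) N → applyUpTo f N ≡ tabulate {n = N} (f ∘ toℕ)
applyUpTo≡tabulate f zero    = refl
applyUpTo≡tabulate f (suc N) = cong (f 0 ∷_) (applyUpTo≡tabulate (f ∘ suc) N)

length-filter-map : ∀ {a b p q} {A : Set a} {B : Set b} {P : B → Set p} {Q : A → Set q}
  (P? : Decidable P) (Q? : Decidable Q) (f : A → B) {xs : List A} →
  All (λ x → (P (f x) → Q x) × (Q x → P (f x))) xs →
  length (filter P? (map f xs)) ≡ length (filter Q? xs)
length-filter-map P? Q? f [] = refl
length-filter-map P? Q? f {x ∷ xs} ((to , from) ∷ rest) with P? (f x) | Q? x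
... | yes _  | yes _  = cong suc (length-filter-map P? Q? f rest)
... | no _   | no _   = length-filter-map P? Q? f rest
... | yes p  | no ¬q  = ⊥-elim (¬q (to p))
... | no ¬p  | yes q  = ⊥-elim (¬p (from q))

length-mono-⊆ : ∀ {xs ys : List ℕ} → Unique xs → (∀ {x} → x ∈ xs → x ∈ ys) → length xs ≤ length ys
length-mono-⊆ {[]}     _                   _     = z≤n
length-mono-⊆ {x ∷ xs} (x∉xs ∷ unique) xs⊆ys with ∈-∃++ (xs⊆ys (here refl))
... | pre , post , refl =
  subst (suc (length xs) ≤_) (sym (length-++-sucʳ pre x post)) (s≤s (length-mono-⊆ unique into-rest))
  where
  into-rest : ∀ {y} → y ∈ xs → y ∈ pre ++ post
  into-rest y∈xs with ∈-++⁻ pre (xs⊆ys (there y∈xs))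
  ... | inj₁ y∈pre           = ∈-++⁺ˡ y∈pre
  ... | inj₂ (here refl)     = ⊥-elim (All.lookup x∉xs y∈xs refl)
  ... | inj₂ (there y∈post)  = ∈-++⁺ʳ pre y∈post

IsPure : ℕ → ℕ → Monomial → Set
IsPure d c (e , xs) = e ≡ d × All (_≡ c) xs

isPure? : ∀ d c → Decidable (IsPure d c)
isPure? d c (e , xs) = (e ℕ.≟ d) ×-dec all? (ℕ._≟ c) xs

-- the sum over r of the coefficients of λ^d x_c^r
coeff : ℕ → ℕ → Poly → ℕ
coeff d c p = length (filter (isPure? d c) p)

coeff-++ : ∀ d c p q → coeff d c (p ++ q) ≡ coeff d c p + coeff d c q
coeff-++ d c p q = trans (cong length (filter-++ (isPure? d c) p q)) (length-++ (filter (isPure? d c) p))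

coeff-↭ : ∀ d c {p q} → p ↭ q → coeff d c p ≡ coeff d c q
coeff-↭ d c p↭q = ↭-length (filter-↭ (isPure? d c) p↭q)

coeff-≡P : ∀ d c {p q} → p ≡P q → coeff d c p ≡ coeff d c q
coeff-≡P d c {p} {q} p≡Pq = trans (sym (normalise p)) (trans (coeff-↭ d c p≡Pq) (normalise q))
  where
  sorted : ∀ m → (IsPure d c (normM m) → IsPure d c m) × (IsPure d c m → IsPure d c (normM m))
  sorted (e , xs) = (λ (e≡d , all) → e≡d , All-resp-↭ (sort-↭ xs) all)
                  , (λ (e≡d , all) → e≡d , All-resp-↭ (↭-sym (sort-↭ xs)) all)
  normalise : ∀ r → coeff d c (map normM r) ≡ coeff d c r
  normalise r = length-filter-map (isPure? d c) (isPure? d c) normM {r} (All.tabulate (λ {m} _ → sorted m))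

coeff-sumP : ∀ d c {N} (h : Fin N → Poly) → coeff d c (sumP (tabulate h)) ≡ ∑[ l < N ] coeff d c (h l)
coeff-sumP d c {zero}  h = refl
coeff-sumP d c {suc N} h = trans (coeff-++ d c (h zero) _) (cong (coeff d c (h zero) +_) (coeff-sumP d c (h ∘ suc)))

coeff-singleton : ∀ d c m → coeff d c (m ∷ []) ≡ 𝟙 (isPure? d c m)
coeff-singleton d c m with isPure? d c m
... | yes pure = cong length (filter-accept (isPure? d c) pure)
... | no ¬pure = cong length (filter-reject (isPure? d c) ¬pure)

λ-free : Poly → Set
λ-free = All ((_≡ 0) ∘ proj₁)

coeff-λ^-≢ : ∀ {d c k p} → k ≢ d → λ-free p → coeff d c (λ^ k · p) ≡ 0
coeff-λ^-≢ {d} {c} {k} k≢d free =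
  cong length (filter-none (isPure? d c) (Allₚ.map⁺ (All.map shifted free)))
  where
  shifted : ∀ {m} → proj₁ m ≡ 0 → ¬ IsPure d c (proj₁ m + k , proj₂ m)
  shifted refl (k≡d , _) = k≢d k≡d

coeff-λ^-≡ : ∀ {d c p} → λ-free p → coeff d c (λ^ d · p) ≡ coeff 0 c p
coeff-λ^-≡ {d} {c} free = length-filter-map (isPure? d c) (isPure? 0 c) _ (All.map shifted free)
  where
  shifted : ∀ {m} → proj₁ m ≡ 0 →
            (IsPure d c (proj₁ m + d , proj₂ m) → IsPure 0 c m) × (IsPure 0 c m → IsPure d c (proj₁ m + d , proj₂ m))
  shifted refl = (λ (_ , all) → refl , all) , (λ (_ , all) → refl , all)

-- The low-degree coefficients of Γ

⊗-tabulate : ∀ {N} (P Q : PMat N) i j → (P ⊗ Q) i j ≡ sumP (tabulate (λ l → P i l *P Q l j))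
⊗-tabulate P Q i j = cong sumP (map-tabulate (λ l → l) (λ l → P i l *P Q l j))

*P-λ-free : ∀ {p q} → λ-free p → λ-free q → λ-free (p *P q)
*P-λ-free []              _     = []
*P-λ-free (refl ∷ free-p) free-q = Allₚ.++⁺ (Allₚ.map⁺ (All.map (λ { refl → refl }) free-q)) (*P-λ-free free-p free-q)

idP-λ-free : ∀ {N} (i j : Fin N) → λ-free (idP i j)
idP-λ-free i j with i Fin.≟ j
... | yes _ = refl ∷ []
... | no _  = []

^P-λ-free : ∀ {N} (G : Mat N) k i j → λ-free ((toP G ^P k) i j)
^P-λ-free G zero    i j = idP-λ-free i j
^P-λ-free G (suc k) i j rewrite ⊗-tabulate (toP G ^P k) (toP G) i j =
  Allₚ.concat⁺ (Allₚ.tabulate⁺ (λ l → *P-λ-free (^P-λ-free G k i l) (refl ∷ [])))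

sumP-[] : ∀ {N} (f : Fin N → Poly) → (∀ l → f l ≡ []) → sumP (tabulate f) ≡ []
sumP-[] {zero}  f f≡[] = refl
sumP-[] {suc N} f f≡[] rewrite f≡[] zero = sumP-[] (f ∘ suc) (f≡[] ∘ suc)

sumP-single : ∀ {N} (f : Fin N → Poly) u → (∀ l → l ≢ u → f l ≡ []) → sumP (tabulate f) ≡ f u
sumP-single {suc N} f zero    f≡[] =
  trans (cong (f zero ++_) (sumP-[] (f ∘ suc) (λ l → f≡[] (suc l) (λ ())))) (++-identityʳ (f zero))
sumP-single {suc N} f (suc u) f≡[] rewrite f≡[] zero (λ ()) =
  sumP-single (f ∘ suc) u (λ l l≢u → f≡[] (suc l) (l≢u ∘ Finₚ.suc-injective))

⊗-identityˡ : ∀ {N} (P : PMat N) i j → (idP ⊗ P) i j ≡ P i j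
⊗-identityˡ P i j = begin
  (idP ⊗ P) i j                                  ≡⟨ ⊗-tabulate idP P i j ⟩
  sumP (tabulate (λ l → idP i l *P P l j))       ≡⟨ sumP-single _ i off-diagonal ⟩
  idP i i *P P i j                               ≡⟨ on-diagonal ⟩
  P i j                                          ∎
  where
  open ≡-Reasoning
  off-diagonal : ∀ l → l ≢ i → idP i l *P P l j ≡ []
  off-diagonal l l≢i with i Fin.≟ l
  ... | yes i≡l = ⊥-elim (l≢i (sym i≡l))
  ... | no _    = refl
  on-diagonal : idP i i *P P i j ≡ P i j
  on-diagonal with i Fin.≟ i
  ... | yes _   = trans (++-identityʳ _) (trans (map-cong (λ { (_ , _) → refl }) (P i j)) (map-id (P i j)))
  ... | no i≢i  = ⊥-elim (i≢i refl)

walks₂ : ∀ {N} → Mat N → ℕ → Fin N → Fin N → ℕ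
walks₂ {N} G c i j = ∑[ l < N ] 𝟙 ((G i l ℕ.≟ c) ×-dec (G l j ℕ.≟ c))

module _ {N} (G : Mat N) where

  private
    T = toP G

  -- powers of toP G are λ-free, so only the term λ^d G^d of Γ G contributes to λ^d
  coeff-Γ : ∀ {d} c i j → d < N → coeff d c (Γ G i j) ≡ coeff 0 c ((T ^P d) i j)
  coeff-Γ {d} c i j d<N = begin
    coeff d c (Γ G i j)                                ≡⟨ cong (coeff d c ∘ sumP) as-tabulate ⟩
    coeff d c (sumP (tabulate {n = N} (term ∘ toℕ)))   ≡⟨ coeff-sumP d c {N} (term ∘ toℕ) ⟩
    ∑[ k < N ] coeff d c (term (toℕ k))                ≡⟨ sum-single (Fin.fromℕ< d<N) other-terms ⟩
    coeff d c (term (toℕ (Fin.fromℕ< d<N)))            ≡⟨ cong (coeff d c ∘ term) (Finₚ.toℕ-fromℕ< d<N) ⟩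
    coeff d c (term d)                                 ≡⟨ coeff-λ^-≡ (^P-λ-free G d i j) ⟩
    coeff 0 c ((T ^P d) i j)                           ∎
    where
    open ≡-Reasoning
    term : ℕ → Poly
    term k = λ^ k · (T ^P k) i j
    as-tabulate : map term (upTo N) ≡ tabulate (term ∘ toℕ)
    as-tabulate = trans (map-upTo term N) (applyUpTo≡tabulate term N)
    other-terms : ∀ k → k ≢ Fin.fromℕ< d<N → coeff d c (term (toℕ k)) ≡ 0
    other-terms k k≢d = coeff-λ^-≢ (λ eq → k≢d (Finₚ.toℕ-injective (trans eq (sym (Finₚ.toℕ-fromℕ< d<N)))))
                                   (^P-λ-free G (toℕ k) i j)

  coeff₀-Γ : ∀ c i j → 0 < N → coeff 0 c (Γ G i j) ≡ 𝟙 (i Fin.≟ j)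
  coeff₀-Γ c i j 0<N = trans (coeff-Γ c i j 0<N) diagonal
    where
    diagonal : coeff 0 c (idP i j) ≡ 𝟙 (i Fin.≟ j)
    diagonal with i Fin.≟ j
    ... | yes _ = refl
    ... | no _  = refl

  coeff₁-Γ : ∀ c i j → 1 < N → coeff 1 c (Γ G i j) ≡ 𝟙 (G i j ℕ.≟ c)
  coeff₁-Γ c i j 1<N = begin
    coeff 1 c (Γ G i j)                      ≡⟨ coeff-Γ c i j 1<N ⟩
    coeff 0 c ((idP ⊗ T) i j)                ≡⟨ cong (coeff 0 c) (⊗-identityˡ T i j) ⟩
    coeff 0 c (T i j)                        ≡⟨ coeff-singleton 0 c _ ⟩
    𝟙 (isPure? 0 c (0 , G i j ∷ []))         ≡⟨ 𝟙-cong _ _ (λ { (_ , e ∷ []) → e }) (λ e → refl , e ∷ []) ⟩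
    𝟙 (G i j ℕ.≟ c)                          ∎
    where open ≡-Reasoning

  coeff₂-Γ : ∀ c i j → 2 < N → coeff 2 c (Γ G i j) ≡ walks₂ G c i j
  coeff₂-Γ c i j 2<N = begin
    coeff 2 c (Γ G i j)                                          ≡⟨ coeff-Γ c i j 2<N ⟩
    coeff 0 c (((idP ⊗ T) ⊗ T) i j)                              ≡⟨ cong (coeff 0 c) (⊗-tabulate (idP ⊗ T) T i j) ⟩
    coeff 0 c (sumP (tabulate (λ l → (idP ⊗ T) i l *P T l j)))   ≡⟨ coeff-sumP 0 c {N} (λ l → (idP ⊗ T) i l *P T l j) ⟩
    ∑[ l < N ] coeff 0 c ((idP ⊗ T) i l *P T l j)                ≡⟨ sum-cong-≗ two-step ⟩
    walks₂ G c i j                                               ∎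
    where
    open ≡-Reasoning
    two-step : ∀ l → coeff 0 c ((idP ⊗ T) i l *P T l j) ≡ 𝟙 ((G i l ℕ.≟ c) ×-dec (G l j ℕ.≟ c))
    two-step l rewrite ⊗-identityˡ T i l =
      trans (coeff-singleton 0 c (0 , G i l ∷ G l j ∷ []))
            (𝟙-cong _ _ (λ { (_ , e ∷ e′ ∷ []) → e , e′ }) (λ (e , e′) → refl , (e All.∷ e′ All.∷ All.[])))

module _ {N} (G : Mat N) {i j s t : Fin N} (Γ≡P : Γ G i j ≡P Γ G s t) where

  Γ≡P⇒diagonal : 0 < N → i ≡ j → s ≡ t
  Γ≡P⇒diagonal 0<N refl = 𝟙-sound (s Fin.≟ t) (subst (0 <_) ones ≤-refl)
    where
    ones : 1 ≡ 𝟙 (s Fin.≟ t)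
    ones = trans (sym (𝟙-yes (i Fin.≟ i) refl))
             (trans (sym (coeff₀-Γ G 0 i i 0<N)) (trans (coeff-≡P 0 0 Γ≡P) (coeff₀-Γ G 0 s t 0<N)))

  Γ≡P⇒label : 1 < N → G i j ≡ G s t
  Γ≡P⇒label 1<N = sym (𝟙-sound (G s t ℕ.≟ G i j) (subst (0 <_) ones ≤-refl))
    where
    ones : 1 ≡ 𝟙 (G s t ℕ.≟ G i j)
    ones = trans (sym (𝟙-yes (G i j ℕ.≟ G i j) refl))
             (trans (sym (coeff₁-Γ G _ i j 1<N)) (trans (coeff-≡P 1 _ Γ≡P) (coeff₁-Γ G _ s t 1<N)))

  Γ≡P⇒walks₂ : 2 < N → ∀ c → walks₂ G c i j ≡ walks₂ G c s t
  Γ≡P⇒walks₂ 2<N c = trans (sym (coeff₂-Γ G c i j 2<N)) (trans (coeff-≡P 2 c Γ≡P) (coeff₂-Γ G c s t 2<N))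

-- Invariance of Γ under automorphisms

module ∑P = Algebra.Properties.CommutativeMonoid.Sum (++-commutativeMonoid {A = Monomial})

sumP-tabulate : ∀ {N} (h : Fin N → Poly) → sumP (tabulate h) ≡ ∑P.sum h
sumP-tabulate {zero}  h = refl
sumP-tabulate {suc N} h = cong (h zero ++_) (sumP-tabulate (h ∘ suc))

⊗-as-sum : ∀ {N} (P Q : PMat N) i j → (P ⊗ Q) i j ≡ ∑P.sum (λ l → P i l *P Q l j)
⊗-as-sum {N} P Q i j = trans (⊗-tabulate P Q i j) (sumP-tabulate {N} (λ l → P i l *P Q l j))

*P-congˡ : ∀ {p p′} q → p ↭ p′ → p *P q ↭ p′ *P q
*P-congˡ q p↭p′ = foldr-commMonoid ++-isCommutativeMonoid (↭⇒↭ₛ′ ↭-isEquivalence (map⁺ _ p↭p′))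

*P-congʳ : ∀ p {q q′} → q ↭ q′ → p *P q ↭ p *P q′
*P-congʳ []      q↭q′ = ↭-refl
*P-congʳ (m ∷ p) q↭q′ = ++⁺ (map⁺ (mulM m) q↭q′) (*P-congʳ p q↭q′)

*P-cong : ∀ {p p′ q q′} → p ↭ p′ → q ↭ q′ → p *P q ↭ p′ *P q′
*P-cong {p′ = p′} {q} p↭p′ q↭q′ = ↭-trans (*P-congˡ q p↭p′) (*P-congʳ p′ q↭q′)

permute-injective : ∀ {N} (σ : Permutation′ N) {x y} → σ ⟨$⟩ʳ x ≡ σ ⟨$⟩ʳ y → x ≡ y
permute-injective σ = Injection.injective (↔⇒↣ σ)

λ^-cong : ∀ k {p q} → p ↭ q → λ^ k · p ↭ λ^ k · q
λ^-cong k = map⁺ _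

module _ {N} (G : Mat N) (σ : Permutation′ N) (σ-aut : IsAut G σ) where

  private
    T = toP G
    π = σ ⟨$⟩ʳ_

  idP-invariant : ∀ i j → idP {N} (π i) (π j) ≡ idP i j
  idP-invariant i j with π i Fin.≟ π j | i Fin.≟ j
  ... | yes _     | yes _   = refl
  ... | no _      | no _    = refl
  ... | yes πi≡πj | no i≢j  = ⊥-elim (i≢j (permute-injective σ πi≡πj))
  ... | no πi≢πj  | yes i≡j = ⊥-elim (πi≢πj (cong π i≡j))

  ^P-invariant : ∀ k i j → (T ^P k) (π i) (π j) ↭ (T ^P k) i j
  ^P-invariant zero    i j = ↭-reflexive (idP-invariant i j)
  ^P-invariant (suc k) i j = begin
    ((T ^P k) ⊗ T) (π i) (π j)                   ≡⟨ ⊗-as-sum (T ^P k) T (π i) (π j) ⟩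
    ∑P.sum (λ l → (T ^P k) (π i) l *P T l (π j))          ↭⟨ ∑P.sum-permute _ σ ⟩
    ∑P.sum (λ l → (T ^P k) (π i) (π l) *P T (π l) (π j))  ↭⟨ ∑P.sum-cong-≋ {N} factors ⟩
    ∑P.sum (λ l → (T ^P k) i l *P T l j)                  ≡⟨ ⊗-as-sum (T ^P k) T i j ⟨
    ((T ^P k) ⊗ T) i j                           ∎
    where
    open PermutationReasoning
    factors : ∀ l → (T ^P k) (π i) (π l) *P T (π l) (π j) ↭ (T ^P k) i l *P T l j
    factors l = *P-cong (^P-invariant k i l) (↭-reflexive (cong (λ x → (0 , x ∷ []) ∷ []) (σ-aut l j)))

  Γ-invariant : ∀ i j → Γ G (π i) (π j) ≡P Γ G i j
  Γ-invariant i j = map⁺ normM (begin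
    Γ G (π i) (π j)                                        ≡⟨ as-sum (π i) (π j) ⟩
    ∑P.sum {N} (λ k → λ^ toℕ k · (T ^P toℕ k) (π i) (π j)) ↭⟨ ∑P.sum-cong-≋ {N} terms ⟩
    ∑P.sum {N} (λ k → λ^ toℕ k · (T ^P toℕ k) i j)         ≡⟨ as-sum i j ⟨
    Γ G i j                                                ∎)
    where
    open PermutationReasoning
    terms : ∀ k → λ^ toℕ k · (T ^P toℕ k) (π i) (π j) ↭ λ^ toℕ k · (T ^P toℕ k) i j
    terms k = λ^-cong (toℕ k) (^P-invariant (toℕ k) i j)
    as-sum : ∀ x y → Γ G x y ≡ ∑P.sum {N} (λ k → λ^ toℕ k · (T ^P toℕ k) x y)
    as-sum x y = trans (cong sumP (trans (map-upTo _ N) (applyUpTo≡tabulate _ N))) (sumP-tabulate {N} _)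

^P-cong : ∀ {N} {G G′ : Mat N} → (∀ i j → G i j ≡ G′ i j) → ∀ k i j → (toP G ^P k) i j ≡ (toP G′ ^P k) i j
^P-cong G≗G′ zero    i j = refl
^P-cong {G = G} {G′} G≗G′ (suc k) i j =
  trans (⊗-tabulate (toP G ^P k) (toP G) i j)
    (trans (cong sumP (tabulate-cong factors)) (sym (⊗-tabulate (toP G′ ^P k) (toP G′) i j)))
  where
  factors : ∀ l → (toP G ^P k) i l *P toP G l j ≡ (toP G′ ^P k) i l *P toP G′ l j
  factors l = cong₂ _*P_ (^P-cong G≗G′ k i l) (cong (λ x → (0 , x ∷ []) ∷ []) (G≗G′ l j))

Γ-cong : ∀ {N} {G G′ : Mat N} → (∀ i j → G i j ≡ G′ i j) → ∀ i j → Γ G i j ≡ Γ G′ i j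
Γ-cong {N} G≗G′ i j = cong sumP (map-cong (λ k → cong (λ^ k ·_) (^P-cong G≗G′ k i j)) (upTo N))

module _ {N} (G : Mat N) where

  ∈-entries : ∀ i j → G i j ∈ entries G
  ∈-entries i j = ∈-concat⁺′ (∈-map⁺ (G i) (∈-allFin j)) (∈-map⁺ (λ i → map (G i) (allFin N)) (∈-allFin i))

  entries-∈ : ∀ {x} → x ∈ entries G → ∃ λ i → ∃ λ j → x ≡ G i j
  entries-∈ x∈ with ∈-concat⁻′ (map (λ i → map (G i) (allFin N)) (allFin N)) x∈
  ... | _ , x∈row , row∈ with ∈-map⁻ (λ i → map (G i) (allFin N)) row∈
  ...   | i , _ , refl with ∈-map⁻ (G i) x∈row
  ...     | j , _ , x≡Gij = i , j , x≡Gij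

  three≤distinct : ∀ {i j s t u v} → G i j ≢ G s t → G i j ≢ G u v → G s t ≢ G u v → 3 ≤ distinct G
  three≤distinct {i} {j} {s} {t} {u} {v} ≢₁ ≢₂ ≢₃ =
    length-mono-⊆ ((≢₁ ∷ ≢₂ ∷ []) ∷ (≢₃ ∷ []) ∷ [] ∷ []) listed
    where
    listed : ∀ {x} → x ∈ G i j ∷ G s t ∷ G u v ∷ [] → x ∈ deduplicate ℕ._≟_ (entries G)
    listed (here refl)                 = ∈-deduplicate⁺ ℕ._≟_ (∈-entries i j)
    listed (there (here refl))         = ∈-deduplicate⁺ ℕ._≟_ (∈-entries s t)
    listed (there (there (here refl))) = ∈-deduplicate⁺ ℕ._≟_ (∈-entries u v)

  distinct≤2 : ∀ a → (∀ i j → G i j ≡ 0 ⊎ G i j ≡ a) → distinct G ≤ 2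
  distinct≤2 a two-valued = length-mono-⊆ (deduplicate-! (entries G)) value
    where
    value : ∀ {x} → x ∈ deduplicate ℕ._≟_ (entries G) → x ∈ 0 ∷ a ∷ []
    value x∈ with entries-∈ (∈-deduplicate⁻ ℕ._≟_ (entries G) x∈)
    ... | i , j , refl with two-valued i j
    ...   | inj₁ Gij≡0 = here Gij≡0
    ...   | inj₂ Gij≡a = there (here Gij≡a)

-- Descriptions and stable graphs

module _ {N} {G H : Mat N} (desc : Desc G H) where

  desc-refines-Γ : ∀ {i j s t} → H i j ≡ H s t → Γ G i j ≡P Γ G s t
  desc-refines-Γ = proj₂ (proj₂ desc _ _ _ _)

  desc-sameAut : 1 < N → SameAut G H
  desc-sameAut 1<N σ = (λ aut i j → proj₁ (proj₂ desc _ _ i j) (Γ-invariant G σ aut i j))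
                     , (λ aut i j → Γ≡P⇒label G (desc-refines-Γ (aut i j)) 1<N)

SameAut-sym : ∀ {N} {G H : Mat N} → SameAut G H → SameAut H G
SameAut-sym G~H σ = proj₂ (G~H σ) , proj₁ (G~H σ)

SameAut-trans : ∀ {N} {G H K : Mat N} → SameAut G H → SameAut H K → SameAut G K
SameAut-trans G~H H~K σ = (proj₁ (H~K σ) ∘ proj₁ (G~H σ)) , (proj₂ (G~H σ) ∘ proj₂ (H~K σ))

SameAut-≗ : ∀ {N} {G H : Mat N} → (∀ i j → G i j ≡ H i j) → SameAut G H
SameAut-≗ G≗H σ = (λ aut i j → trans (sym (G≗H _ _)) (trans (aut i j) (G≗H i j)))
                , (λ aut i j → trans (G≗H _ _) (trans (aut i j) (sym (G≗H i j))))

module StableGraph {N} {G H : Mat N} (stable : Stable G H) where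

  index : ℕ
  index = proj₁ stable

  chain : ℕ → Mat N
  chain = proj₁ (proj₂ stable)

  private
    chain-start : ∀ i j → chain 0 i j ≡ G i j
    chain-start = proj₁ (proj₂ (proj₂ stable))

    chain-desc : ∀ m → Desc (chain m) (chain (suc m))
    chain-desc = proj₁ (proj₂ (proj₂ (proj₂ stable)))

    chain-stops : distinct (chain (suc index)) ≤ distinct (chain index)
    chain-stops = proj₁ (proj₂ (proj₂ (proj₂ (proj₂ (proj₂ stable)))))

    chain-end : ∀ i j → H i j ≡ chain index i j
    chain-end = proj₂ (proj₂ (proj₂ (proj₂ (proj₂ (proj₂ stable)))))

  chain-sameAut : 1 < N → ∀ m → SameAut G (chain m)
  chain-sameAut 1<N zero    = SameAut-≗ (λ i j → sym (chain-start i j))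
  chain-sameAut 1<N (suc m) = SameAut-trans (chain-sameAut 1<N m) (desc-sameAut (chain-desc m) 1<N)

  stable-sameAut : 1 < N → SameAut G H
  stable-sameAut 1<N = SameAut-trans (chain-sameAut 1<N index) (SameAut-≗ (λ i j → sym (chain-end i j)))

  chain-refines-Γ : 1 < N → ∀ m {i j s t} → chain (suc m) i j ≡ chain (suc m) s t → Γ G i j ≡P Γ G s t
  chain-refines-Γ 1<N zero {i} {j} {s} {t} eq =
    subst₂ _≡P_ (Γ-cong chain-start i j) (Γ-cong chain-start s t) (desc-refines-Γ (chain-desc 0) eq)
  chain-refines-Γ 1<N (suc m) eq =
    chain-refines-Γ 1<N m (Γ≡P⇒label (chain (suc m)) (desc-refines-Γ (chain-desc (suc m)) eq) 1<N)

  stable-refines-Γ : 1 < N → 0 < index → ∀ {i j s t} → H i j ≡ H s t → Γ G i j ≡P Γ G s t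
  stable-refines-Γ 1<N 0<index {i} {j} {s} {t} eq with index | chain-end
  ... | suc m | end = chain-refines-Γ 1<N m (trans (sym (end i j)) (trans eq (end s t)))

  stable-positive : 0 < index → ∀ i j → 0 < H i j
  stable-positive 0<index i j with index | chain-end
  ... | suc m | end = subst (0 <_) (sym (end i j)) (proj₁ (chain-desc m) i j)

  index-positive : 1 < N → ∀ a → (∀ i j → G i j ≡ 0 ⊎ G i j ≡ a) →
                   ∀ {x y s t} → x ≢ y → s ≢ t → G x y ≢ G s t → 0 < index
  index-positive 1<N a two-valued {x} {y} {s} {t} x≢y s≢t Gxy≢Gst with index | chain-stops
  ... | suc _ | _    = s≤s z≤n
  ... | zero  | stop = ⊥-elim (<-irrefl refl (≤-trans three (≤-trans stop two)))
    where
    0<N : 0 < N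
    0<N = ≤-trans (s≤s z≤n) 1<N
    Γ₀≡P : ∀ {i j k l} → chain 1 i j ≡ chain 1 k l → Γ (chain 0) i j ≡P Γ (chain 0) k l
    Γ₀≡P = desc-refines-Γ (chain-desc 0)
    three : 3 ≤ distinct (chain 1)
    three = three≤distinct (chain 1) {x} {x} {x} {y} {s} {t}
      (λ eq → x≢y (Γ≡P⇒diagonal (chain 0) (Γ₀≡P eq) 0<N refl))
      (λ eq → s≢t (Γ≡P⇒diagonal (chain 0) (Γ₀≡P eq) 0<N refl))
      (λ eq → Gxy≢Gst (trans (sym (chain-start x y)) (trans (Γ≡P⇒label (chain 0) (Γ₀≡P eq) 1<N) (chain-start s t))))
    two : distinct (chain 0) ≤ 2
    two = distinct≤2 (chain 0) a (λ i j → subst (λ v → v ≡ 0 ⊎ v ≡ a) (sym (chain-start i j)) (two-valued i j))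

two-valued-zero-pattern : ∀ {N} {G : Mat N} {a} → (∀ x y → G x y ≡ 0 ⊎ G x y ≡ a) →
  ∀ {x y s t} → (G x y ≡ 0 → G s t ≡ 0) → (G s t ≡ 0 → G x y ≡ 0) → G x y ≡ G s t
two-valued-zero-pattern two-valued {x} {y} {s} {t} to from with two-valued x y | two-valued s t
... | inj₁ Gxy≡0 | _          = trans Gxy≡0 (sym (to Gxy≡0))
... | inj₂ _     | inj₁ Gst≡0 = trans (from Gst≡0) (sym Gst≡0)
... | inj₂ Gxy≡a | inj₂ Gst≡a = trans Gxy≡a (sym Gst≡a)

module _ {N} (B M : Mat N) where

  Ψ-diagonal : ∀ i → Ψ B M i i ≡ M i i
  Ψ-diagonal i with i Fin.≟ i
  ... | yes _   = refl
  ... | no i≢i  = ⊥-elim (i≢i refl)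

  Ψ-nonedge : ∀ {i j} → i ≢ j → B i j ≡ 0 → Ψ B M i j ≡ 0
  Ψ-nonedge {i} {j} i≢j Bij≡0 with i Fin.≟ j | B i j ℕ.≟ 0
  ... | yes i≡j | _          = ⊥-elim (i≢j i≡j)
  ... | no _    | yes _      = refl
  ... | no _    | no Bij≢0   = ⊥-elim (Bij≢0 Bij≡0)

  Ψ-edge : ∀ {i j} → B i j ≢ 0 → Ψ B M i j ≡ M i j
  Ψ-edge {i} {j} Bij≢0 with i Fin.≟ j | B i j ℕ.≟ 0
  ... | yes _ | _          = refl
  ... | no _  | yes Bij≡0  = ⊥-elim (Bij≢0 Bij≡0)
  ... | no _  | no _       = refl

  Ψ-zero : (∀ i j → 0 < M i j) → ∀ {i j} → Ψ B M i j ≡ 0 → B i j ≡ 0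
  Ψ-zero M-positive {i} {j} Ψij≡0 with i Fin.≟ j | B i j ℕ.≟ 0
  ... | _     | yes Bij≡0 = Bij≡0
  ... | yes _ | no _      = ⊥-elim (<-irrefl (sym Ψij≡0) (M-positive i j))
  ... | no _  | no _      = ⊥-elim (<-irrefl (sym Ψij≡0) (M-positive i j))

module _ {N} (m : ℕ) (P : Mat N) where

  Φ-diagonal : ∀ i → Φ m P i i ≡ P i i
  Φ-diagonal i with toℕ i <? m | i Fin.≟ i
  ... | yes _ | yes _  = refl
  ... | yes _ | no i≢i = ⊥-elim (i≢i refl)
  ... | no _  | _      = refl

  Φ-outerˡ : ∀ {i} j → ¬ toℕ i < m → Φ m P i j ≡ P i j
  Φ-outerˡ {i} j i≥m with toℕ i <? m
  ... | yes i<m = ⊥-elim (i≥m i<m)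
  ... | no _    = refl

  Φ-outerʳ : ∀ i {j} → ¬ toℕ j < m → Φ m P i j ≡ P i j
  Φ-outerʳ i {j} j≥m with toℕ i <? m | toℕ j <? m
  ... | _     | yes j<m = ⊥-elim (j≥m j<m)
  ... | yes _ | no _    = refl
  ... | no _  | no _    = refl

  Φ-inner : ∀ {i j} → toℕ i < m → toℕ j < m → i ≢ j → Φ m P i j ≡ 0
  Φ-inner {i} {j} i<m j<m i≢j with toℕ i <? m | toℕ j <? m | i Fin.≟ j
  ... | yes _ | yes _ | no _    = refl
  ... | yes _ | yes _ | yes i≡j = ⊥-elim (i≢j i≡j)
  ... | yes _ | no j≥m | _      = ⊥-elim (j≥m j<m)
  ... | no i≥m | _     | _      = ⊥-elim (i≥m i<m)

module _ {N} {B M : Mat N} {a} (B-two-valued : ∀ x y → B x y ≡ 0 ⊎ B x y ≡ a) (B-diagonal : ∀ x → B x x ≡ 0)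
         (M-positive : ∀ i j → 0 < M i j) where

  Ψ-determines-B : ∀ {x y s t} → x ≢ y → s ≢ t → Ψ B M x y ≡ Ψ B M s t → B x y ≡ B s t
  Ψ-determines-B x≢y s≢t Ψxy≡Ψst = two-valued-zero-pattern B-two-valued
    (λ Bxy≡0 → Ψ-zero B M M-positive (trans (sym Ψxy≡Ψst) (Ψ-nonedge B M x≢y Bxy≡0)))
    (λ Bst≡0 → Ψ-zero B M M-positive (trans Ψxy≡Ψst (Ψ-nonedge B M s≢t Bst≡0)))

  Ψ-sameAut : SameAut B M → SameAut B (Ψ B M)
  Ψ-sameAut B~M σ = B-aut⇒Ψ-aut , Ψ-aut⇒B-aut
    where
    π = σ ⟨$⟩ʳ_
    B-aut⇒Ψ-aut : IsAut B σ → IsAut (Ψ B M) σ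
    B-aut⇒Ψ-aut aut i j = by-cases (i Fin.≟ j) (B i j ℕ.≟ 0)
      where
      by-cases : Dec (i ≡ j) → Dec (B i j ≡ 0) → Ψ B M (π i) (π j) ≡ Ψ B M i j
      by-cases (yes refl) _ = trans (Ψ-diagonal B M (π i)) (trans (proj₁ (B~M σ) aut i i) (sym (Ψ-diagonal B M i)))
      by-cases (no i≢j) (yes Bij≡0) =
        trans (Ψ-nonedge B M (i≢j ∘ permute-injective σ) (trans (aut i j) Bij≡0)) (sym (Ψ-nonedge B M i≢j Bij≡0))
      by-cases (no _)   (no Bij≢0) =
        trans (Ψ-edge B M (Bij≢0 ∘ trans (sym (aut i j)))) (trans (proj₁ (B~M σ) aut i j) (sym (Ψ-edge B M Bij≢0)))
    Ψ-aut⇒B-aut : IsAut (Ψ B M) σ → IsAut B σ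
    Ψ-aut⇒B-aut aut i j with i Fin.≟ j
    ... | yes refl = trans (B-diagonal (π i)) (sym (B-diagonal i))
    ... | no i≢j   = Ψ-determines-B (i≢j ∘ permute-injective σ) i≢j (aut i j)

-- Binding graphs

others : ∀ {n} → 2 < n → (u : Fin n) → ∃ λ v₁ → ∃ λ v₂ → u ≢ v₁ × u ≢ v₂ × v₁ ≢ v₂
others (s≤s (s≤s (s≤s _))) zero          = suc zero , suc (suc zero) , (λ ()) , (λ ()) , (λ ())
others (s≤s (s≤s (s≤s _))) (suc zero)    = zero , suc (suc zero) , (λ ()) , (λ ()) , (λ ())
others (s≤s (s≤s (s≤s _))) (suc (suc _)) = zero , suc zero , (λ ()) , (λ ()) , (λ ())

Reach⇒neighbour : ∀ {N} {G : Mat N} {u v} → Reach G u v → u ≢ v → ∃ λ w → Adj G u w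
Reach⇒neighbour here         u≢u = ⊥-elim (u≢u refl)
Reach⇒neighbour (step u~w _) _   = _ , u~w

pairs : ℕ → ℕ
pairs m = ∑[ u < m ] ∑[ v < m ] 𝟙 (u Finₚ.<? v)

pairs-suc : ∀ m → pairs (suc m) ≡ m + pairs m
pairs-suc m = cong₂ _+_ first-row other-rows
  where
  first-row : ∑[ v < suc m ] 𝟙 (zero {m} Finₚ.<? v) ≡ m
  first-row = cong₂ _+_ (𝟙-no (zero {m} Finₚ.<? zero {m}) (λ ()))
                (trans (sum-cong-≗ {m} (λ v → 𝟙-yes (zero {m} Finₚ.<? suc v) (s≤s z≤n))) (sum-ones m))
  other-rows : ∑[ u < m ] ∑[ v < suc m ] 𝟙 (suc u Finₚ.<? v) ≡ pairs m
  other-rows = sum-cong-≗ {m} λ u → cong₂ _+_ (𝟙-no (suc u Finₚ.<? zero {m}) (λ ()))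
                 (sum-cong-≗ {m} λ v → 𝟙-cong (suc u Finₚ.<? suc v) (u Finₚ.<? v) (λ { (s≤s u<v) → u<v }) s≤s)

-- stated in the shape of the hypothesis (n + k) * 2 ≡ n * suc n on the number k of binding vertices
pairs-formula : ∀ m → (m + pairs m) * 2 ≡ m * suc m
pairs-formula zero    = refl
pairs-formula (suc m) = begin
  (suc m + pairs (suc m)) * 2   ≡⟨ cong (λ p → (suc m + p) * 2) (pairs-suc m) ⟩
  (suc m + (m + pairs m)) * 2   ≡⟨ regroup m (pairs m) ⟩
  (m + pairs m) * 2 + 2 * suc m ≡⟨ cong (_+ 2 * suc m) (pairs-formula m) ⟩
  m * suc m + 2 * suc m         ≡⟨ expand m ⟩
  suc m * suc (suc m)           ∎
  where
  open ≡-Reasoning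
  regroup : ∀ m p → (suc m + (m + p)) * 2 ≡ (m + p) * 2 + 2 * suc m
  regroup = solve-∀
  expand : ∀ m → m * suc m + 2 * suc m ≡ suc m * suc (suc m)
  expand = solve-∀

module BindingGraph {n k : ℕ} (A : Mat n) (B : Mat (n + k)) (binding : IsBinding A B) where

  V : Set
  V = Fin (n + k)

  original : Fin n → V
  original u = u ↑ˡ k

  hub : Fin k → V
  hub q = n ↑ʳ q

  IsOriginal : V → Set
  IsOriginal x = toℕ x < n

  NeighboursIn : V → V → V → Set
  NeighboursIn z x y = ∀ w → Adj B z w → w ≡ x ⊎ w ≡ y

  B-symmetric : Symmetric B
  B-symmetric = proj₁ binding

  B-diagonal : ∀ x → B x x ≡ 0
  B-diagonal = proj₁ (proj₁ (proj₂ binding))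

  label : ℕ
  label = proj₁ (proj₂ (proj₁ (proj₂ binding)))

  B-two-valued : ∀ x y → B x y ≡ 0 ⊎ B x y ≡ label
  B-two-valued = proj₂ (proj₂ (proj₁ (proj₂ binding)))

  B-restricts : ∀ u v → B (original u) (original v) ≡ A u v
  B-restricts = proj₁ (proj₂ (proj₂ binding))

  module _ {u v : Fin n} (u≢v : u ≢ v) where

    private
      binds = proj₂ (proj₂ (proj₂ binding)) u v u≢v

    binder : Fin k
    binder = proj₁ binds

    binder-neighbours : NeighboursIn (hub binder) (original u) (original v)
    binder-neighbours = proj₁ (proj₂ binds)

    binder-adjˡ : Adj B (hub binder) (original u)
    binder-adjˡ = proj₁ (proj₂ (proj₂ binds))

    binder-adjʳ : Adj B (hub binder) (original v)
    binder-adjʳ = proj₁ (proj₂ (proj₂ (proj₂ binds)))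

  original-injective : ∀ {u v} → original u ≡ original v → u ≡ v
  original-injective = Finₚ.↑ˡ-injective k _ _

  original-isOriginal : ∀ u → IsOriginal (original u)
  original-isOriginal u = subst (_< n) (sym (Finₚ.toℕ-↑ˡ u k)) (Finₚ.toℕ<n u)

  hub-notOriginal : ∀ q → ¬ IsOriginal (hub q)
  hub-notOriginal q h = <-irrefl refl (≤-trans h (subst (n ≤_) (sym (Finₚ.toℕ-↑ʳ n q)) (m≤m+n n (toℕ q))))

  original≢hub : ∀ u q → original u ≢ hub q
  original≢hub u q eq = hub-notOriginal q (subst IsOriginal eq (original-isOriginal u))

  vertex-view : ∀ x → (∃ λ u → x ≡ original u) ⊎ (∃ λ q → x ≡ hub q)
  vertex-view x with splitAt n x in eq
  ... | inj₁ u = inj₁ (u , sym (Finₚ.splitAt⁻¹-↑ˡ eq))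
  ... | inj₂ q = inj₂ (q , sym (Finₚ.splitAt⁻¹-↑ʳ eq))

  binder-pair : ∀ {u v u′ v′} (u≢v : u ≢ v) (u′≢v′ : u′ ≢ v′) → binder u≢v ≡ binder u′≢v′ →
                (u′ ≡ u ⊎ u′ ≡ v) × (v′ ≡ u ⊎ v′ ≡ v)
  binder-pair u≢v u′≢v′ eq =
    back (binder-neighbours u≢v _ (subst (λ q → Adj B (hub q) _) (sym eq) (binder-adjˡ u′≢v′))) ,
    back (binder-neighbours u≢v _ (subst (λ q → Adj B (hub q) _) (sym eq) (binder-adjʳ u′≢v′)))
    where
    back : ∀ {w u v} → original w ≡ original u ⊎ original w ≡ original v → w ≡ u ⊎ w ≡ v
    back (inj₁ eq) = inj₁ (original-injective eq)
    back (inj₂ eq) = inj₂ (original-injective eq)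

  NeighboursIn-rebase : ∀ {z x y x′ y′} → NeighboursIn z x′ y′ →
                        x ≡ x′ ⊎ x ≡ y′ → y ≡ x′ ⊎ y ≡ y′ → x ≢ y → NeighboursIn z x y
  NeighboursIn-rebase nbrs (inj₁ refl) (inj₂ refl) _   = nbrs
  NeighboursIn-rebase nbrs (inj₂ refl) (inj₁ refl) _ w z~w with nbrs w z~w
  ... | inj₁ w≡x′ = inj₂ w≡x′
  ... | inj₂ w≡y′ = inj₁ w≡y′
  NeighboursIn-rebase nbrs (inj₁ refl) (inj₁ refl) x≢y = ⊥-elim (x≢y refl)
  NeighboursIn-rebase nbrs (inj₂ refl) (inj₂ refl) x≢y = ⊥-elim (x≢y refl)

  nonzero⇒label : ∀ {x y} → B x y ≢ 0 → B x y ≡ label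
  nonzero⇒label {x} {y} Bxy≢0 with B-two-valued x y
  ... | inj₁ Bxy≡0     = ⊥-elim (Bxy≢0 Bxy≡0)
  ... | inj₂ Bxy≡label = Bxy≡label

  nonzero⇒Adj : ∀ {x y} → B x y ≢ 0 → Adj B x y
  nonzero⇒Adj {x} Bxy≢0 = (λ { refl → Bxy≢0 (B-diagonal x) }) , Bxy≢0

  B-zero-pattern : ∀ {x y s t} → (B x y ≡ 0 → B s t ≡ 0) → (B s t ≡ 0 → B x y ≡ 0) → B x y ≡ B s t
  B-zero-pattern = two-valued-zero-pattern B-two-valued

  module _ (2<n : 2 < n) where

    label≢0 : label ≢ 0
    label≢0 label≡0 with others 2<n (Fin.fromℕ< (≤-trans (s≤s z≤n) 2<n))
    ... | _ , _ , u≢v , _ = proj₂ (binder-adjˡ u≢v) (trans (nonzero⇒label (proj₂ (binder-adjˡ u≢v))) label≡0)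

    label⇒nonzero : ∀ {x y} → B x y ≡ label → B x y ≢ 0
    label⇒nonzero Bxy≡label Bxy≡0 = label≢0 (trans (sym Bxy≡label) Bxy≡0)

    walks₂-through-hub : ∀ {z x y} → NeighboursIn z x y → Adj B z y → walks₂ B label z x ≡ 𝟙 (B y x ℕ.≟ label)
    walks₂-through-hub {z} {x} {y} nbrs z~y = trans (sum-single y no-other-walk) through-y
      where
      no-other-walk : ∀ l → l ≢ y → 𝟙 ((B z l ℕ.≟ label) ×-dec (B l x ℕ.≟ label)) ≡ 0
      no-other-walk l l≢y = 𝟙-no _ λ (Bzl≡a , Blx≡a) → case nbrs l (nonzero⇒Adj (label⇒nonzero Bzl≡a)) of λ
        { (inj₁ refl) → label≢0 (trans (sym Blx≡a) (B-diagonal l))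
        ; (inj₂ l≡y)  → l≢y l≡y }
      through-y : 𝟙 ((B z y ℕ.≟ label) ×-dec (B y x ℕ.≟ label)) ≡ 𝟙 (B y x ℕ.≟ label)
      through-y = 𝟙-cong _ _ proj₂ (nonzero⇒label (proj₂ z~y) ,_)

    label-indicator-injective : ∀ {x y s t} → 𝟙 (B x y ℕ.≟ label) ≡ 𝟙 (B s t ℕ.≟ label) → B x y ≡ B s t
    label-indicator-injective eq = B-zero-pattern (zero-transfers eq) (zero-transfers (sym eq))
      where
      zero-transfers : ∀ {x y s t} → 𝟙 (B x y ℕ.≟ label) ≡ 𝟙 (B s t ℕ.≟ label) → B x y ≡ 0 → B s t ≡ 0
      zero-transfers {x} {y} {s} {t} eq Bxy≡0 with B-two-valued s t
      ... | inj₁ Bst≡0     = Bst≡0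
      ... | inj₂ Bst≡label = ⊥-elim (label≢0 (trans (sym (𝟙-sound (B x y ℕ.≟ label) positive)) Bxy≡0))
        where
        positive : 0 < 𝟙 (B x y ℕ.≟ label)
        positive = subst (0 <_) (trans (sym (𝟙-yes (B s t ℕ.≟ label) Bst≡label)) (sym eq)) (s≤s z≤n)

    hubs-reveal-edge : ∀ {z x y z′ x′ y′} → NeighboursIn z x y → Adj B z y →
                       NeighboursIn z′ x′ y′ → Adj B z′ y′ →
                       walks₂ B label z x ≡ walks₂ B label z′ x′ → B y x ≡ B y′ x′
    hubs-reveal-edge nbrs z~y nbrs′ z′~y′ eq = label-indicator-injective
      (trans (sym (walks₂-through-hub nbrs z~y)) (trans eq (walks₂-through-hub nbrs′ z′~y′)))

    degree : V → ℕ
    degree x = walks₂ B label x x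

    neighbour-walk : ∀ {x l} → B x l ≢ 0 → 0 < 𝟙 ((B x l ℕ.≟ label) ×-dec (B l x ℕ.≟ label))
    neighbour-walk {x} {l} Bxl≢0 =
      subst (0 <_) (sym (𝟙-yes _ (nonzero⇒label Bxl≢0 , nonzero⇒label (Bxl≢0 ∘ trans (B-symmetric x l))))) (s≤s z≤n)

    degree-bound : ∀ {z x y} → NeighboursIn z x y → degree z ≤ 2
    degree-bound nbrs = sum≤two-points _ (λ _ → 𝟙≤1 _)
      (λ l pos → nbrs l (nonzero⇒Adj (label⇒nonzero (proj₁ (𝟙-sound _ pos)))))

    degree-original : Connected A → ∀ u → 3 ≤ degree (original u)
    degree-original connected u with others 2<n u
    ... | v₁ , v₂ , u≢v₁ , u≢v₂ , v₁≢v₂ with Reach⇒neighbour (connected u v₁) u≢v₁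
    ...   | w , _ , Auw≢0 =
      three-points≤sum _ b₁≢b₂ (b≢o u≢v₁) (b≢o u≢v₂)
        (neighbour-walk (flip-nonzero (proj₂ (binder-adjˡ u≢v₁))))
        (neighbour-walk (flip-nonzero (proj₂ (binder-adjˡ u≢v₂))))
        (neighbour-walk (Auw≢0 ∘ trans (sym (B-restricts u w))))
      where
      flip-nonzero : ∀ {x y} → B x y ≢ 0 → B y x ≢ 0
      flip-nonzero {x} {y} Bxy≢0 = Bxy≢0 ∘ trans (B-symmetric x y)
      b≢o : ∀ {v} (u≢v : u ≢ v) → hub (binder u≢v) ≢ original w
      b≢o u≢v = original≢hub w _ ∘ sym
      b₁≢b₂ : hub (binder u≢v₁) ≢ hub (binder u≢v₂)
      b₁≢b₂ eq with proj₂ (binder-pair u≢v₁ u≢v₂ (Finₚ.↑ʳ-injective n _ _ eq))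
      ... | inj₁ v₂≡u  = u≢v₂ (sym v₂≡u)
      ... | inj₂ v₂≡v₁ = v₁≢v₂ (sym v₂≡v₁)

    module _ (size : (n + k) * 2 ≡ n * suc n) where

      pairs≡k : pairs n ≡ k
      pairs≡k = +-cancelˡ-≡ n _ _ (*-cancelʳ-≡ _ _ 2 (trans (pairs-formula n) (sym size)))

      hits : Fin k → Fin n → Fin n → ℕ
      hits q u v with u Fin.≟ v
      ... | yes _  = 0
      ... | no u≢v = 𝟙 ((u Finₚ.<? v) ×-dec (q Fin.≟ binder u≢v))

      hits-sound : ∀ {q} u v → 0 < hits q u v → Σ (u ≢ v) λ u≢v → u Fin.< v × q ≡ binder u≢v
      hits-sound {q} u v pos with u Fin.≟ v
      ... | no u≢v = u≢v , 𝟙-sound ((u Finₚ.<? v) ×-dec (q Fin.≟ binder u≢v)) pos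

      hits≤1 : ∀ q u v → hits q u v ≤ 1
      hits≤1 q u v with u Fin.≟ v
      ... | yes _ = z≤n
      ... | no _  = 𝟙≤1 _

      sum-hits : ∀ u v → ∑[ q < k ] hits q u v ≡ 𝟙 (u Finₚ.<? v)
      sum-hits u v with u Fin.≟ v
      ... | yes refl = trans (sum-zero {k} (λ _ → refl)) (sym (𝟙-no (u Finₚ.<? u) (Finₚ.<-irrefl refl)))
      ... | no u≢v   = trans (sum-single (binder u≢v) (λ q q≢b → 𝟙-no _ (q≢b ∘ proj₂)))
                              (𝟙-cong _ _ proj₁ (_, refl))

      hits-total : ∑[ q < k ] ∑[ u < n ] ∑[ v < n ] hits q u v ≡ k
      hits-total = begin
        ∑[ q < k ] ∑[ u < n ] ∑[ v < n ] hits q u v   ≡⟨ ∑-comm (λ q u → ∑[ v < n ] hits q u v) ⟩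
        ∑[ u < n ] ∑[ q < k ] ∑[ v < n ] hits q u v   ≡⟨ sum-cong-≗ (λ u → ∑-comm (λ q v → hits q u v)) ⟩
        ∑[ u < n ] ∑[ v < n ] ∑[ q < k ] hits q u v   ≡⟨ sum-cong-≗ (λ u → sum-cong-≗ (sum-hits u)) ⟩
        pairs n                                        ≡⟨ pairs≡k ⟩
        k                                              ∎
        where open ≡-Reasoning

      hits-unique : ∀ q → ∑[ u < n ] ∑[ v < n ] hits q u v ≤ 1
      hits-unique q = sum-≤1 _ row≤1 same-row
        where
        row≤1 : ∀ u → ∑[ v < n ] hits q u v ≤ 1
        row≤1 u = sum-≤1 _ (hits≤1 q u) same-column
          where
          same-column : ∀ v v′ → 0 < hits q u v → 0 < hits q u v′ → v ≡ v′
          same-column v v′ pos pos′ with hits-sound u v pos | hits-sound u v′ pos′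
          ... | u≢v , _ , q≡b | u≢v′ , _ , q≡b′ with proj₂ (binder-pair u≢v u≢v′ (trans (sym q≡b) q≡b′))
          ...   | inj₁ v′≡u = ⊥-elim (u≢v′ (sym v′≡u))
          ...   | inj₂ v′≡v = sym v′≡v
        same-row : ∀ u u′ → 0 < ∑[ v < n ] hits q u v → 0 < ∑[ v < n ] hits q u′ v → u ≡ u′
        same-row u u′ pos pos′ with sum-positive _ pos | sum-positive _ pos′
        ... | v , hit | v′ , hit′ with hits-sound u v hit | hits-sound u′ v′ hit′
        ...   | u≢v , u<v , q≡b | u′≢v′ , u′<v′ , q≡b′
          with binder-pair {u} {v} {u′} {v′} u≢v u′≢v′ (trans (sym q≡b) q≡b′)
        ...     | inj₁ u′≡u , _         = sym u′≡u
        ...     | inj₂ refl , inj₁ refl = ⊥-elim (Finₚ.<-asym u<v u′<v′)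
        ...     | inj₂ refl , inj₂ refl = ⊥-elim (u′≢v′ refl)

      -- the pairs u < v have distinct binders and there are exactly k of them
      hub-is-binder : ∀ q → ∃ λ u → ∃ λ v → Σ (u ≢ v) λ u≢v → q ≡ binder u≢v
      hub-is-binder q with sum-positive _ (≤1∧sum≡size⇒positive _ hits-unique hits-total q)
      ... | u , row-hit with sum-positive _ row-hit
      ...   | v , hit with hits-sound u v hit
      ...     | u≢v , _ , q≡b = u , v , u≢v , q≡b

      degree-hub : ∀ q → degree (hub q) ≤ 2
      degree-hub q with hub-is-binder q
      ... | _ , _ , u≢v , refl = degree-bound (binder-neighbours u≢v)

      nonoriginal-neighbours : ∀ {z x y} → ¬ IsOriginal z → Adj B z x → Adj B z y → x ≢ y → NeighboursIn z x y
      nonoriginal-neighbours {z} ¬z z~x z~y x≢y with vertex-view z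
      ... | inj₁ (u , refl) = ⊥-elim (¬z (original-isOriginal u))
      ... | inj₂ (q , refl) with hub-is-binder q
      ...   | _ , _ , u≢v , refl =
        NeighboursIn-rebase (binder-neighbours u≢v) (binder-neighbours u≢v _ z~x) (binder-neighbours u≢v _ z~y) x≢y

      degree-separates-original : Connected A → ∀ {x y} → degree x ≡ degree y → IsOriginal x → IsOriginal y
      degree-separates-original connected {x} {y} eq x-original with vertex-view x | vertex-view y
      ... | inj₂ (q , refl) | _               = ⊥-elim (hub-notOriginal q x-original)
      ... | inj₁ _          | inj₁ (v , refl) = original-isOriginal v
      ... | inj₁ (u , refl) | inj₂ (q , refl) =
        ⊥-elim (<-irrefl refl (≤-trans (subst (3 ≤_) eq (degree-original connected u)) (degree-hub q)))

module StableBindingGraph {n k : ℕ} (2<n : 2 < n) (size : (n + k) * 2 ≡ n * suc n)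
  (A : Mat n) (connected : Connected A) (B : Mat (n + k)) (binding : IsBinding A B)
  (M : Mat (n + k)) (stable : Stable B M) where

  open BindingGraph A B binding
  open StableGraph stable

  2<N : 2 < n + k
  2<N = ≤-trans 2<n (m≤m+n n k)

  1<N : 1 < n + k
  1<N = ≤-trans (s≤s (s≤s z≤n)) 2<N

  -- the binder of u and v₁ is adjacent to u but not to v₂: B has an off-diagonal edge and non-edge
  M-index-positive : 0 < index
  M-index-positive with others 2<n (Fin.fromℕ< (≤-trans (s≤s z≤n) 2<n))
  ... | v₁ , v₂ , u≢v₁ , u≢v₂ , v₁≢v₂ =
    index-positive 1<N label B-two-valued (original≢hub _ _ ∘ sym) (original≢hub _ _ ∘ sym)
      (λ eq → proj₂ (binder-adjˡ u≢v₁) (trans eq not-adjacent))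
    where
    not-adjacent : B (hub (binder u≢v₁)) (original v₂) ≡ 0
    not-adjacent with B-two-valued (hub (binder u≢v₁)) (original v₂)
    ... | inj₁ B≡0     = B≡0
    ... | inj₂ B≡label with binder-neighbours u≢v₁ _ (nonzero⇒Adj (label⇒nonzero 2<n B≡label))
    ...   | inj₁ eq = ⊥-elim (u≢v₂ (sym (original-injective eq)))
    ...   | inj₂ eq = ⊥-elim (v₁≢v₂ (sym (original-injective eq)))

  B~M : SameAut B M
  B~M = stable-sameAut 1<N

  M-positive : ∀ i j → 0 < M i j
  M-positive = stable-positive M-index-positive

  M-determines-walks₂ : ∀ {i j s t} → M i j ≡ M s t → walks₂ B label i j ≡ walks₂ B label s t
  M-determines-walks₂ eq = Γ≡P⇒walks₂ B (stable-refines-Γ 1<N M-index-positive eq) 2<N label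

  B~Ψ : SameAut B (Ψ B M)
  B~Ψ = Ψ-sameAut B-two-valued B-diagonal M-positive B~M

  module _ (σ : Permutation′ (n + k)) (M-loops : ∀ x → M (σ ⟨$⟩ʳ x) (σ ⟨$⟩ʳ x) ≡ M x x) where

    private
      π = σ ⟨$⟩ʳ_

    originality-preserved : ∀ x → IsOriginal x → IsOriginal (π x)
    originality-preserved x = degree-separates-original 2<n size connected (M-determines-walks₂ (sym (M-loops x)))

    originality-reflected : ∀ x → IsOriginal (π x) → IsOriginal x
    originality-reflected x = degree-separates-original 2<n size connected (M-determines-walks₂ (M-loops x))

  B-aut⇒Φ-aut : ∀ σ → IsAut B σ → IsAut (Φ n (Ψ B M)) σ
  B-aut⇒Φ-aut σ aut i j = by-cases (i Fin.≟ j) (toℕ i <? n) (toℕ j <? n)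
    where
    π = σ ⟨$⟩ʳ_
    Ψ-aut : IsAut (Ψ B M) σ
    Ψ-aut = proj₁ (B~Ψ σ) aut
    M-loops : ∀ x → M (π x) (π x) ≡ M x x
    M-loops x = proj₁ (B~M σ) aut x x
    by-cases : Dec (i ≡ j) → Dec (IsOriginal i) → Dec (IsOriginal j) → Φ n (Ψ B M) (π i) (π j) ≡ Φ n (Ψ B M) i j
    by-cases (yes refl) _ _ = trans (Φ-diagonal n _ (π i)) (trans (Ψ-aut i i) (sym (Φ-diagonal n _ i)))
    by-cases (no _) (no ¬i) _ =
      trans (Φ-outerˡ n _ (π j) (¬i ∘ originality-reflected σ M-loops i)) (trans (Ψ-aut i j) (sym (Φ-outerˡ n _ j ¬i)))
    by-cases (no _) _ (no ¬j) =
      trans (Φ-outerʳ n _ (π i) (¬j ∘ originality-reflected σ M-loops j)) (trans (Ψ-aut i j) (sym (Φ-outerʳ n _ i ¬j)))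
    by-cases (no i≢j) (yes i-orig) (yes j-orig) =
      trans (Φ-inner n _ (originality-preserved σ M-loops i i-orig) (originality-preserved σ M-loops j j-orig)
                         (i≢j ∘ permute-injective σ))
            (sym (Φ-inner n _ i-orig j-orig i≢j))

  module _ (σ : Permutation′ (n + k)) (aut : IsAut (Φ n (Ψ B M)) σ) where

    private
      π = σ ⟨$⟩ʳ_

    Φ-aut-loops : ∀ x → M (π x) (π x) ≡ M x x
    Φ-aut-loops x = begin
      M (π x) (π x)                  ≡⟨ Ψ-diagonal B M (π x) ⟨
      Ψ B M (π x) (π x)              ≡⟨ Φ-diagonal n _ (π x) ⟨
      Φ n (Ψ B M) (π x) (π x)        ≡⟨ aut x x ⟩
      Φ n (Ψ B M) x x                ≡⟨ Φ-diagonal n _ x ⟩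
      Ψ B M x x                      ≡⟨ Ψ-diagonal B M x ⟩
      M x x                          ∎
      where open ≡-Reasoning

    Ψ-outerˡ : ∀ i j → ¬ IsOriginal i → Ψ B M (π i) (π j) ≡ Ψ B M i j
    Ψ-outerˡ i j ¬i = trans (sym (Φ-outerˡ n _ (π j) (¬i ∘ originality-reflected σ Φ-aut-loops i)))
                            (trans (aut i j) (Φ-outerˡ n _ j ¬i))

    Ψ-outerʳ : ∀ i j → ¬ IsOriginal j → Ψ B M (π i) (π j) ≡ Ψ B M i j
    Ψ-outerʳ i j ¬j = trans (sym (Φ-outerʳ n _ (π i) (¬j ∘ originality-reflected σ Φ-aut-loops j)))
                            (trans (aut i j) (Φ-outerʳ n _ i ¬j))

    B-from-Ψ : ∀ {i j} → i ≢ j → Ψ B M (π i) (π j) ≡ Ψ B M i j → B (π i) (π j) ≡ B i j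
    B-from-Ψ i≢j = Ψ-determines-B B-two-valued B-diagonal M-positive (i≢j ∘ permute-injective σ) i≢j

    hub-edge : ∀ p x → ¬ IsOriginal p → B p x ≢ 0 → B (π p) (π x) ≢ 0 × M (π p) (π x) ≡ M p x
    hub-edge p x ¬p Bpx≢0 = πp~πx , trans (sym (Ψ-edge B M πp~πx)) (trans (Ψ-outerˡ p x ¬p) (Ψ-edge B M Bpx≢0))
      where
      πp~πx : B (π p) (π x) ≢ 0
      πp~πx = Bpx≢0 ∘ trans (sym (B-from-Ψ (proj₁ (nonzero⇒Adj Bpx≢0)) (Ψ-outerˡ p x ¬p)))

    -- π maps the binder p of u and v to a binder of π u and π v, and 2-walks from binders reveal edges
    original-edge : ∀ {u v} → u ≢ v → B (π (original u)) (π (original v)) ≡ B (original u) (original v)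
    original-edge {u} {v} u≢v = begin
      B (π (original u)) (π (original v))   ≡⟨ B-symmetric _ _ ⟩
      B (π (original v)) (π (original u))   ≡⟨ revealed ⟨
      B (original v) (original u)           ≡⟨ B-symmetric _ _ ⟩
      B (original u) (original v)           ∎
      where
      open ≡-Reasoning
      p = hub (binder u≢v)
      ¬p : ¬ IsOriginal p
      ¬p = hub-notOriginal _
      to-u = hub-edge p (original u) ¬p (proj₂ (binder-adjˡ u≢v))
      to-v = hub-edge p (original v) ¬p (proj₂ (binder-adjʳ u≢v))
      πp-neighbours : NeighboursIn (π p) (π (original u)) (π (original v))
      πp-neighbours = nonoriginal-neighbours 2<n size (¬p ∘ originality-reflected σ Φ-aut-loops p)
        (nonzero⇒Adj (proj₁ to-u)) (nonzero⇒Adj (proj₁ to-v)) (u≢v ∘ original-injective ∘ permute-injective σ)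
      revealed : B (original v) (original u) ≡ B (π (original v)) (π (original u))
      revealed = hubs-reveal-edge 2<n (binder-neighbours u≢v) (binder-adjʳ u≢v) πp-neighbours
        (nonzero⇒Adj (proj₁ to-v)) (M-determines-walks₂ (sym (proj₂ to-u)))

    original-case : ∀ i j → i ≢ j → IsOriginal i → IsOriginal j → B (π i) (π j) ≡ B i j
    original-case i j i≢j i-orig j-orig with vertex-view i | vertex-view j
    ... | inj₂ (q , refl) | _               = ⊥-elim (hub-notOriginal q i-orig)
    ... | _               | inj₂ (q , refl) = ⊥-elim (hub-notOriginal q j-orig)
    ... | inj₁ (u , refl) | inj₁ (v , refl) = original-edge (i≢j ∘ cong original)

    Φ-aut⇒B-aut : IsAut B σ
    Φ-aut⇒B-aut i j = by-cases (i Fin.≟ j) (toℕ i <? n) (toℕ j <? n)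
      where
      by-cases : Dec (i ≡ j) → Dec (IsOriginal i) → Dec (IsOriginal j) → B (π i) (π j) ≡ B i j
      by-cases (yes refl) _ _                   = trans (B-diagonal (π i)) (sym (B-diagonal i))
      by-cases (no i≢j) (no ¬i) _               = B-from-Ψ i≢j (Ψ-outerˡ i j ¬i)
      by-cases (no i≢j) _ (no ¬j)               = B-from-Ψ i≢j (Ψ-outerʳ i j ¬j)
      by-cases (no i≢j) (yes i-orig) (yes j-orig) = original-case i j i≢j i-orig j-orig

  B~Φ : SameAut B (Φ n (Ψ B M))
  B~Φ σ = B-aut⇒Φ-aut σ , Φ-aut⇒B-aut σ

theorem8 : ∀ (n k : ℕ) → 2 < n → (n + k) * 2 ≡ n * suc n →
    (A : Mat n) → Symmetric A → Simple A → Connected A →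
    (B : Mat (n + k)) → IsBinding A B →
    (M : Mat (n + k)) → Stable B M →
    (Ψ̂ : Mat (n + k)) → Stable (Ψ B M) Ψ̂ →
    (Φ̂ : Mat (n + k)) → Stable (Φ n (Ψ B M)) Φ̂ →
    SameAut B M × SameAut M Ψ̂ × SameAut Ψ̂ Φ̂ × SameAut Φ̂ (Φ n (Ψ B M))
theorem8 n k 2<n size A _ _ connected B binding M M-stable Ψ̂ Ψ̂-stable Φ̂ Φ̂-stable =
  B~M ,
  SameAut-trans (SameAut-sym B~M) (SameAut-trans B~Ψ Ψ~Ψ̂) ,
  SameAut-trans (SameAut-sym Ψ~Ψ̂) (SameAut-trans (SameAut-sym B~Ψ) (SameAut-trans B~Φ Φ~Φ̂)) ,
  SameAut-sym Φ~Φ̂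
  where
  open StableBindingGraph 2<n size A connected B binding M M-stable
  Ψ~Ψ̂ : SameAut (Ψ B M) Ψ̂
  Ψ~Ψ̂ = StableGraph.stable-sameAut Ψ̂-stable 1<N
  Φ~Φ̂ : SameAut (Φ n (Ψ B M)) Φ̂
  Φ~Φ̂ = StableGraph.stable-sameAut Φ̂-stable 1<N
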